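{- Let $\langle\mathbf A,\exists,\forall\rangle$ be a finitely subdirectly irreducible monadic MV-algebra of width $\le k$. Then $\mathbf A$ has at most $k$ maximal filters.
   Context: A monadic MV-algebra is an MV-algebra $\mathbf A$ with unary operations $\exists,\forall$ satisfying: - $\forall x\rightarrow x\approx1$; - $\forall(x\rightarrow\forall y)\approx\exists x\rightarrow\forall y$; - $\forall(\forall x\rightarrow y)\approx\forall x\rightarrow\forall y$; - $\forall(\exists x\vee y)\approx\exists x\vee\forall y$; - $\exists(x*x)\approx\exists x*\exists x$. It is finitely subdirectly irreducible if it is nontrivial and its identity congruence is meet-irreducible. It has width $\le k$ ($k$ a positive integer) if it satisfies the identity \[ \bigwedge_{1\le i<j\le k+1}\forall(x_i\vee x_j)\rightarrow\bigvee_{i=1}^{k+1}\forall x_i\approx1 . \] A filter of an MV-algebra is a subset containing $1$, upward closed and closed under $*$; a maximal filter is a maximal proper filter. -}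

module Defs where

open import Data.Nat using (ℕ; zero; suc)
open import Data.Fin using (Fin; zero; suc; _<_)
open import Data.Fin.Properties using (_<?_)
open import Data.Product using (Σ; _×_; ∃-syntax)
open import Data.Sum using (_⊎_)
open import Data.Empty using (⊥)
open import Relation.Nullary using (¬_; yes; no)
open import Relation.Binary.PropositionalEquality using (_≡_)

record MVAlgebra : Set₁ where
  infixl 8 _⊕_
  field
    Carrier : Set
    _⊕_ : Carrier → Carrier → Carrier
    neg : Carrier → Carrier
    𝟘 : Carrier
    ⊕-assoc : ∀ x y z → (x ⊕ y) ⊕ z ≡ x ⊕ (y ⊕ z)
    ⊕-comm : ∀ x y → x ⊕ y ≡ y ⊕ x
    ⊕-identity : ∀ x → x ⊕ 𝟘 ≡ x
    neg-involutive : ∀ x → neg (neg x) ≡ x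
    ⊕-absorb : ∀ x → x ⊕ neg 𝟘 ≡ neg 𝟘
    luk : ∀ x y → neg (neg x ⊕ y) ⊕ y ≡ neg (neg y ⊕ x) ⊕ x

  𝟙 : Carrier
  𝟙 = neg 𝟘

  infixl 9 _*_
  _*_ : Carrier → Carrier → Carrier
  x * y = neg (neg x ⊕ neg y)

  infixr 5 _⇒_
  _⇒_ : Carrier → Carrier → Carrier
  x ⇒ y = neg x ⊕ y

  infixl 6 _∨_
  _∨_ : Carrier → Carrier → Carrier
  x ∨ y = neg (neg x ⊕ y) ⊕ y

  infixl 7 _∧_
  _∧_ : Carrier → Carrier → Carrier
  x ∧ y = neg (neg x ∨ neg y)

  ⋀ : {n : ℕ} → (Fin n → Carrier) → Carrier
  ⋀ {zero} f = 𝟙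
  ⋀ {suc n} f = f zero ∧ ⋀ (λ i → f (suc i))

  ⋁ : {n : ℕ} → (Fin n → Carrier) → Carrier
  ⋁ {zero} f = 𝟘
  ⋁ {suc n} f = f zero ∨ ⋁ (λ i → f (suc i))

  record IsFilter (F : Carrier → Set) : Set where
    field
      has-𝟙 : F 𝟙
      upward : ∀ x y → F x → x ⇒ y ≡ 𝟙 → F y
      *-closed : ∀ x y → F x → F y → F (x * y)

  Proper : (Carrier → Set) → Set
  Proper F = Σ Carrier (λ x → ¬ F x)

  record IsMaximalFilter (F : Carrier → Set) : Set₁ where
    field
      isFilter : IsFilter F
      proper : Proper F
      maximal : (G : Carrier → Set) → IsFilter G → Proper G →
                (∀ x → F x → G x) → ∀ x → G x → F x

record MonadicMVAlgebra : Set₁ where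
  field
    mv : MVAlgebra
  open MVAlgebra mv public
  field
    ∃' : Carrier → Carrier
    ∀' : Carrier → Carrier
    ax1 : ∀ x → ∀' x ⇒ x ≡ 𝟙
    ax2 : ∀ x y → ∀' (x ⇒ ∀' y) ≡ (∃' x ⇒ ∀' y)
    ax3 : ∀ x y → ∀' (∀' x ⇒ y) ≡ (∀' x ⇒ ∀' y)
    ax4 : ∀ x y → ∀' (∃' x ∨ y) ≡ (∃' x ∨ ∀' y)
    ax5 : ∀ x → ∃' (x * x) ≡ ∃' x * ∃' x

  record IsCongruence (θ : Carrier → Carrier → Set) : Set where
    field
      refl' : ∀ x → θ x x
      sym' : ∀ x y → θ x y → θ y x
      trans' : ∀ x y z → θ x y → θ y z → θ x z
      ⊕-cong : ∀ x x' y y' → θ x x' → θ y y' → θ (x ⊕ y) (x' ⊕ y')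
      neg-cong : ∀ x x' → θ x x' → θ (neg x) (neg x')
      ∃-cong : ∀ x x' → θ x x' → θ (∃' x) (∃' x')
      ∀-cong : ∀ x x' → θ x x' → θ (∀' x) (∀' x')

  -- θ is the identity congruence Δ (θ ⊆ Δ; Δ ⊆ θ holds by reflexivity)
  IsIdentity : (Carrier → Carrier → Set) → Set
  IsIdentity θ = ∀ x y → θ x y → x ≡ y

  Nontrivial : Set
  Nontrivial = Σ Carrier (λ x → Σ Carrier (λ y → ¬ (x ≡ y)))

  -- finitely subdirectly irreducible: nontrivial and Δ is meet-irreducible
  -- in the congruence lattice (meet = intersection)
  FSI : Set₁
  FSI = Nontrivial ×
        ((θ ψ : Carrier → Carrier → Set) → IsCongruence θ → IsCongruence ψ →
         IsIdentity (λ x y → θ x y × ψ x y) → IsIdentity θ ⊎ IsIdentity ψ)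

  pairTerm : {n : ℕ} → (Fin n → Carrier) → Fin n → Fin n → Carrier
  pairTerm x i j with i <? j
  ... | yes _ = ∀' (x i ∨ x j)
  ... | no _ = 𝟙

  WidthLE : ℕ → Set
  WidthLE k = (x : Fin (suc k) → Carrier) →
    (⋀ (λ i → ⋀ (λ j → pairTerm x i j)) ⇒ ⋁ (λ i → ∀' (x i))) ≡ 𝟙

{-# OPTIONS --safe #-}
-- Distinct maximal filters M i, M j are separated by some w with w ∈ M i and neg w ∈ M j.
-- This is classical, but the goal is ⊥, so all choices can be made under a double negation.
-- Since neg (w * w) ∨ neg (neg w * neg w) ≡ 𝟙, meets of squared separators give elements
-- pᵢ ∈ M i whose negations are pairwise codisjoint, so the width identity yields
-- ⋁ᵢ ∀' (neg pᵢ) ≡ 𝟙. In a finitely subdirectly irreducible algebra 𝟙 is join-prime among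
-- ∀'-fixed elements: if u ∨ v ≡ 𝟙, the congruences of the monadic filters generated by u
-- and v meet in the identity, so one of them is the identity and u ≡ 𝟙 or v ≡ 𝟙.
-- Hence some neg pᵢ ≡ 𝟙, i.e. 𝟘 ∈ M i, contradicting properness.
module Submission where

open import Defs
open import Data.Nat using (ℕ; zero; suc; _≤_; _+_)
open import Data.Fin using (Fin; zero; suc; _<?_)
open import Data.Fin.Properties using (_≟_; <⇒≢; sequence)
open import Data.Empty using (⊥; ⊥-elim)
open import Data.Product using (∃-syntax; _×_; _,_; proj₁)
open import Data.Sum using (_⊎_; inj₁; inj₂)
open import Effect.Monad using (RawMonad)
open import Relation.Binary.Bundles using (Preorder)
open import Relation.Nullary using (¬_; yes; no)
open import Relation.Nullary.Negation using (¬¬-Monad; ¬¬-map)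
open import Relation.Binary.PropositionalEquality
  using (_≡_; _≢_; refl; sym; trans; cong; cong₂; subst; subst₂; isEquivalence; module ≡-Reasoning)
import Relation.Binary.Reasoning.Preorder as PreorderReasoning

¬¬-∀Fin : ∀ {n} {P : Fin n → Set} → (∀ i → ¬ ¬ P i) → ¬ ¬ (∀ i → P i)
¬¬-∀Fin = sequence (RawMonad.rawApplicative ¬¬-Monad)

module MVProperties (A : MVAlgebra) where
  open MVAlgebra A

  neg-𝟙 : neg 𝟙 ≡ 𝟘
  neg-𝟙 = neg-involutive 𝟘

  ⊕-identityˡ : ∀ x → 𝟘 ⊕ x ≡ x
  ⊕-identityˡ x = trans (⊕-comm 𝟘 x) (⊕-identity x)

  ⊕-zeroˡ : ∀ x → 𝟙 ⊕ x ≡ 𝟙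
  ⊕-zeroˡ x = trans (⊕-comm 𝟙 x) (⊕-absorb x)

  ⇒-identityˡ : ∀ x → 𝟙 ⇒ x ≡ x
  ⇒-identityˡ x = trans (cong (_⊕ x) neg-𝟙) (⊕-identityˡ x)

  ⊕-inverseˡ : ∀ x → neg x ⊕ x ≡ 𝟙
  ⊕-inverseˡ x = begin
    neg x ⊕ x             ≡⟨ cong (λ z → neg z ⊕ x) (⇒-identityˡ x) ⟨
    neg (neg 𝟙 ⊕ x) ⊕ x   ≡⟨ luk x 𝟙 ⟨
    neg (neg x ⊕ 𝟙) ⊕ 𝟙   ≡⟨ ⊕-absorb _ ⟩
    𝟙                     ∎
    where open ≡-Reasoning

  neg-* : ∀ x y → neg (x * y) ≡ neg x ⊕ neg y
  neg-* x y = neg-involutive _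

  *-⇒ : ∀ x y z → x * y ⇒ z ≡ x ⇒ y ⇒ z
  *-⇒ x y z = trans (cong (_⊕ z) (neg-* x y)) (⊕-assoc (neg x) (neg y) z)

  ⇒-contrapositive : ∀ x y → neg y ⇒ neg x ≡ x ⇒ y
  ⇒-contrapositive x y = trans (cong (_⊕ neg x) (neg-involutive y)) (⊕-comm y (neg x))

  infix 4 _≼_
  _≼_ : Carrier → Carrier → Set
  x ≼ y = x ⇒ y ≡ 𝟙

  ≼-refl : ∀ x → x ≼ x
  ≼-refl = ⊕-inverseˡ

  ≼-reflexive : ∀ {x y} → x ≡ y → x ≼ y
  ≼-reflexive {x} refl = ≼-refl x

  x≼𝟙 : ∀ x → x ≼ 𝟙
  x≼𝟙 x = ⊕-absorb (neg x)

  𝟘≼x : ∀ x → 𝟘 ≼ x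
  𝟘≼x = ⊕-zeroˡ

  x≼x⊕y : ∀ x y → x ≼ x ⊕ y
  x≼x⊕y x y = trans (sym (⊕-assoc (neg x) x y)) (trans (cong (_⊕ y) (⊕-inverseˡ x)) (⊕-zeroˡ y))

  -- neg (neg y ⊕ x) is the truncated difference y ⊖ x.
  ≼-split : ∀ {x y} → x ≼ y → y ≡ x ⊕ neg (neg y ⊕ x)
  ≼-split {x} {y} x≼y = begin
    y                         ≡⟨ ⊕-identityˡ y ⟨
    𝟘 ⊕ y                     ≡⟨ cong (_⊕ y) neg-𝟙 ⟨
    neg 𝟙 ⊕ y                 ≡⟨ cong (λ z → neg z ⊕ y) x≼y ⟨
    neg (neg x ⊕ y) ⊕ y       ≡⟨ luk x y ⟩
    neg (neg y ⊕ x) ⊕ x       ≡⟨ ⊕-comm _ x ⟩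
    x ⊕ neg (neg y ⊕ x)       ∎
    where open ≡-Reasoning

  ≼-trans : ∀ {x y z} → x ≼ y → y ≼ z → x ≼ z
  ≼-trans {x} {y} {z} x≼y y≼z = subst (x ≼_) (sym z≡x⊕d) (x≼x⊕y x _)
    where
    open ≡-Reasoning
    z≡x⊕d : z ≡ x ⊕ (neg (neg y ⊕ x) ⊕ neg (neg z ⊕ y))
    z≡x⊕d = begin
      z                                         ≡⟨ ≼-split y≼z ⟩
      y ⊕ neg (neg z ⊕ y)                       ≡⟨ cong (_⊕ neg (neg z ⊕ y)) (≼-split x≼y) ⟩
      (x ⊕ neg (neg y ⊕ x)) ⊕ neg (neg z ⊕ y)   ≡⟨ ⊕-assoc _ _ _ ⟩
      x ⊕ (neg (neg y ⊕ x) ⊕ neg (neg z ⊕ y))   ∎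

  ≼-antisym : ∀ {x y} → x ≼ y → y ≼ x → x ≡ y
  ≼-antisym {x} {y} x≼y y≼x = sym (begin
    y                     ≡⟨ ≼-split x≼y ⟩
    x ⊕ neg (neg y ⊕ x)   ≡⟨ cong (λ z → x ⊕ neg z) y≼x ⟩
    x ⊕ neg 𝟙             ≡⟨ cong (x ⊕_) neg-𝟙 ⟩
    x ⊕ 𝟘                 ≡⟨ ⊕-identity x ⟩
    x                     ∎)
    where open ≡-Reasoning

  ≼-preorder : Preorder _ _ _
  ≼-preorder = record
    { Carrier = Carrier
    ; _≈_ = _≡_
    ; _≲_ = _≼_
    ; isPreorder = record { isEquivalence = isEquivalence ; reflexive = ≼-reflexive ; trans = ≼-trans }
    }

  module ≼-Reasoning = PreorderReasoning ≼-preorder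

  𝟙≼⇒≡𝟙 : ∀ {x} → 𝟙 ≼ x → x ≡ 𝟙
  𝟙≼⇒≡𝟙 {x} = ≼-antisym (x≼𝟙 x)

  ⊕-monoˡ-≼ : ∀ {x y} z → x ≼ y → x ⊕ z ≼ y ⊕ z
  ⊕-monoˡ-≼ {x} {y} z x≼y = subst (x ⊕ z ≼_) (sym y⊕z≡x⊕z⊕d) (x≼x⊕y (x ⊕ z) d)
    where
    open ≡-Reasoning
    d = neg (neg y ⊕ x)
    y⊕z≡x⊕z⊕d : y ⊕ z ≡ (x ⊕ z) ⊕ d
    y⊕z≡x⊕z⊕d = begin
      y ⊕ z         ≡⟨ cong (_⊕ z) (≼-split x≼y) ⟩
      (x ⊕ d) ⊕ z   ≡⟨ ⊕-assoc x d z ⟩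
      x ⊕ (d ⊕ z)   ≡⟨ cong (x ⊕_) (⊕-comm d z) ⟩
      x ⊕ (z ⊕ d)   ≡⟨ ⊕-assoc x z d ⟨
      (x ⊕ z) ⊕ d   ∎

  ⊕-monoʳ-≼ : ∀ {x y} z → x ≼ y → z ⊕ x ≼ z ⊕ y
  ⊕-monoʳ-≼ {x} {y} z x≼y = subst₂ _≼_ (⊕-comm x z) (⊕-comm y z) (⊕-monoˡ-≼ z x≼y)

  neg-antitone : ∀ {x y} → x ≼ y → neg y ≼ neg x
  neg-antitone {x} {y} = trans (⇒-contrapositive x y)

  neg-antitone⁻ : ∀ {x y} → neg x ≼ neg y → y ≼ x
  neg-antitone⁻ {x} {y} h = subst₂ _≼_ (neg-involutive y) (neg-involutive x) (neg-antitone h)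

  ⇒-antitoneˡ-≼ : ∀ {x y} z → x ≼ y → y ⇒ z ≼ x ⇒ z
  ⇒-antitoneˡ-≼ z x≼y = ⊕-monoˡ-≼ z (neg-antitone x≼y)

  ⇒-monoʳ-≼ : ∀ {x y} z → x ≼ y → z ⇒ x ≼ z ⇒ y
  ⇒-monoʳ-≼ z = ⊕-monoʳ-≼ (neg z)

  *-comm : ∀ x y → x * y ≡ y * x
  *-comm x y = cong neg (⊕-comm (neg x) (neg y))

  *-assoc : ∀ x y z → (x * y) * z ≡ x * (y * z)
  *-assoc x y z = cong neg (begin
    neg (x * y) ⊕ neg z       ≡⟨ cong (_⊕ neg z) (neg-* x y) ⟩
    (neg x ⊕ neg y) ⊕ neg z   ≡⟨ ⊕-assoc (neg x) (neg y) (neg z) ⟩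
    neg x ⊕ (neg y ⊕ neg z)   ≡⟨ cong (neg x ⊕_) (neg-* y z) ⟨
    neg x ⊕ neg (y * z)       ∎)
    where open ≡-Reasoning

  *-identityʳ : ∀ x → x * 𝟙 ≡ x
  *-identityʳ x = trans (cong (λ z → neg (neg x ⊕ z)) neg-𝟙)
                        (trans (cong neg (⊕-identity (neg x))) (neg-involutive x))

  *-identityˡ : ∀ x → 𝟙 * x ≡ x
  *-identityˡ x = trans (*-comm 𝟙 x) (*-identityʳ x)

  *-interchange : ∀ w x y z → (w * x) * (y * z) ≡ (w * y) * (x * z)
  *-interchange w x y z = begin
    (w * x) * (y * z)   ≡⟨ *-assoc w x (y * z) ⟩
    w * (x * (y * z))   ≡⟨ cong (w *_) (*-assoc x y z) ⟨
    w * ((x * y) * z)   ≡⟨ cong (λ u → w * (u * z)) (*-comm x y) ⟩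
    w * ((y * x) * z)   ≡⟨ cong (w *_) (*-assoc y x z) ⟩
    w * (y * (x * z))   ≡⟨ *-assoc w y (x * z) ⟨
    (w * y) * (x * z)   ∎
    where open ≡-Reasoning

  x*y≼x : ∀ x y → x * y ≼ x
  x*y≼x x y = subst (x * y ≼_) (neg-involutive x) (neg-antitone (x≼x⊕y (neg x) (neg y)))

  x*y≼y : ∀ x y → x * y ≼ y
  x*y≼y x y = subst (_≼ y) (*-comm y x) (x*y≼x y x)

  *-monoˡ-≼ : ∀ {x y} z → x ≼ y → x * z ≼ y * z
  *-monoˡ-≼ z x≼y = neg-antitone (⊕-monoˡ-≼ (neg z) (neg-antitone x≼y))

  *-monoʳ-≼ : ∀ {x y} z → x ≼ y → z * x ≼ z * y
  *-monoʳ-≼ {x} {y} z x≼y = subst₂ _≼_ (*-comm x z) (*-comm y z) (*-monoˡ-≼ z x≼y)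

  *-mono-≼ : ∀ {w x y z} → w ≼ x → y ≼ z → w * y ≼ x * z
  *-mono-≼ {w} {x} {y} {z} w≼x y≼z = ≼-trans (*-monoˡ-≼ y w≼x) (*-monoʳ-≼ x y≼z)

  curry-≼ : ∀ {x y z} → x * y ≼ z → x ≼ y ⇒ z
  curry-≼ {x} {y} {z} = trans (sym (*-⇒ x y z))

  uncurry-≼ : ∀ {x y z} → x ≼ y ⇒ z → x * y ≼ z
  uncurry-≼ {x} {y} {z} = trans (*-⇒ x y z)

  modus-ponens : ∀ x y → (x ⇒ y) * x ≼ y
  modus-ponens x y = uncurry-≼ (≼-refl (x ⇒ y))

  ⇒-*-trans : ∀ x y z → (x ⇒ y) * (y ⇒ z) ≼ x ⇒ z
  ⇒-*-trans x y z = curry-≼ (begin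
    ((x ⇒ y) * (y ⇒ z)) * x   ≡⟨ cong (_* x) (*-comm _ _) ⟩
    ((y ⇒ z) * (x ⇒ y)) * x   ≡⟨ *-assoc _ _ x ⟩
    (y ⇒ z) * ((x ⇒ y) * x)   ∼⟨ *-monoʳ-≼ (y ⇒ z) (modus-ponens x y) ⟩
    (y ⇒ z) * y               ∼⟨ modus-ponens y z ⟩
    z                         ∎)
    where open ≼-Reasoning

  ∨-comm : ∀ x y → x ∨ y ≡ y ∨ x
  ∨-comm = luk

  y≼x∨y : ∀ x y → y ≼ x ∨ y
  y≼x∨y x y = subst (y ≼_) (⊕-comm y _) (x≼x⊕y y _)

  x≼x∨y : ∀ x y → x ≼ x ∨ y
  x≼x∨y x y = subst (x ≼_) (∨-comm y x) (y≼x∨y y x)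

  -- x ∨ y unfolds to (x ⇒ y) ⇒ y.
  ∨-lub : ∀ {x y z} → x ≼ z → y ≼ z → x ∨ y ≼ z
  ∨-lub {x} {y} {z} x≼z y≼z = begin
    x ∨ y                 ∼⟨ ⇒-antitoneˡ-≼ y (⇒-antitoneˡ-≼ y x≼z) ⟩
    z ∨ y                 ≡⟨ ∨-comm z y ⟩
    neg (y ⇒ z) ⊕ z       ≡⟨ cong (λ u → neg u ⊕ z) y≼z ⟩
    𝟙 ⇒ z                 ≡⟨ ⇒-identityˡ z ⟩
    z                     ∎
    where open ≼-Reasoning

  ⇒-≼-⊕ʳ : ∀ x y z → x ⇒ y ≼ x ⊕ z ⇒ y ⊕ z
  ⇒-≼-⊕ʳ x y z = begin
    neg x ⊕ y                   ∼⟨ ⊕-monoˡ-≼ y negx≼[x⊕z]⇒z ⟩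
    (neg (x ⊕ z) ⊕ z) ⊕ y       ≡⟨ ⊕-assoc _ z y ⟩
    neg (x ⊕ z) ⊕ (z ⊕ y)       ≡⟨ cong (neg (x ⊕ z) ⊕_) (⊕-comm z y) ⟩
    neg (x ⊕ z) ⊕ (y ⊕ z)       ∎
    where
    open ≼-Reasoning
    negx≼[x⊕z]⇒z : neg x ≼ neg (x ⊕ z) ⊕ z
    negx≼[x⊕z]⇒z = subst (λ u → neg x ≼ neg (u ⊕ z) ⊕ z) (neg-involutive x) (x≼x∨y (neg x) z)

  ⇒-≼-⊕ˡ : ∀ x y z → x ⇒ y ≼ z ⊕ x ⇒ z ⊕ y
  ⇒-≼-⊕ˡ x y z = subst (λ u → x ⇒ y ≼ u) (cong₂ _⇒_ (⊕-comm x z) (⊕-comm y z)) (⇒-≼-⊕ʳ x y z)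

  ∨-mono-≼ : ∀ {w x y z} → w ≼ x → y ≼ z → w ∨ y ≼ x ∨ z
  ∨-mono-≼ {w} {x} {y} {z} w≼x y≼z = ∨-lub (≼-trans w≼x (x≼x∨y x z)) (≼-trans y≼z (y≼x∨y x z))

  ∨-zeroˡ : ∀ x → 𝟙 ∨ x ≡ 𝟙
  ∨-zeroˡ x = trans (cong (λ z → neg z ⊕ x) (⇒-identityˡ x)) (⊕-inverseˡ x)

  ∨-identityʳ : ∀ x → x ∨ 𝟘 ≡ x
  ∨-identityʳ x = trans (⊕-identity _) (trans (cong neg (⊕-identity (neg x))) (neg-involutive x))

  x∧y≼x : ∀ x y → x ∧ y ≼ x
  x∧y≼x x y = neg-antitone⁻ (subst (neg x ≼_) (sym (neg-involutive _)) (x≼x∨y (neg x) (neg y)))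

  x∧y≼y : ∀ x y → x ∧ y ≼ y
  x∧y≼y x y = neg-antitone⁻ (subst (neg y ≼_) (sym (neg-involutive _)) (y≼x∨y (neg x) (neg y)))

  ∧-greatest : ∀ {x y z} → z ≼ x → z ≼ y → z ≼ x ∧ y
  ∧-greatest {x} {y} {z} z≼x z≼y =
    subst (_≼ x ∧ y) (neg-involutive z) (neg-antitone (∨-lub (neg-antitone z≼x) (neg-antitone z≼y)))

  ⋀-lowerBound : ∀ {n} (f : Fin n → Carrier) i → ⋀ f ≼ f i
  ⋀-lowerBound f zero = x∧y≼x _ _
  ⋀-lowerBound f (suc i) = ≼-trans (x∧y≼y _ _) (⋀-lowerBound (λ j → f (suc j)) i)

  ⋀-greatest : ∀ {n z} (f : Fin n → Carrier) → (∀ i → z ≼ f i) → z ≼ ⋀ f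
  ⋀-greatest {zero} {z} f _ = x≼𝟙 z
  ⋀-greatest {suc n} f z≼f = ∧-greatest (z≼f zero) (⋀-greatest (λ j → f (suc j)) (λ j → z≼f (suc j)))

  ⋀-𝟙 : ∀ {n} (f : Fin n → Carrier) → (∀ i → f i ≡ 𝟙) → ⋀ f ≡ 𝟙
  ⋀-𝟙 f f≡𝟙 = 𝟙≼⇒≡𝟙 (⋀-greatest f (λ i → ≼-reflexive (sym (f≡𝟙 i))))

  -- x ∨ y ≡ 𝟙 unfolds to x ⇒ y ≼ y.
  *-∨≡𝟙 : ∀ {x y z} → x ∨ y ≡ 𝟙 → z ∨ y ≡ 𝟙 → x * z ∨ y ≡ 𝟙
  *-∨≡𝟙 {x} {y} {z} x∨y≡𝟙 z∨y≡𝟙 = begin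
    x * z ⇒ y     ≡⟨ *-⇒ x z y ⟩
    x ⇒ z ⇒ y     ∼⟨ ⇒-monoʳ-≼ x z∨y≡𝟙 ⟩
    x ⇒ y         ∼⟨ x∨y≡𝟙 ⟩
    y             ∎
    where open ≼-Reasoning

  ∨≡𝟙-mono : ∀ {w x y z} → w ≼ x → y ≼ z → w ∨ y ≡ 𝟙 → x ∨ z ≡ 𝟙
  ∨≡𝟙-mono {x = x} {z = z} w≼x y≼z w∨y≡𝟙 = 𝟙≼⇒≡𝟙 (subst (_≼ x ∨ z) w∨y≡𝟙 (∨-mono-≼ w≼x y≼z))

  infixr 10 _^_
  _^_ : Carrier → ℕ → Carrier
  x ^ zero = 𝟙
  x ^ suc n = x * x ^ n

  ^-distribˡ-+-* : ∀ x m n → x ^ (m + n) ≡ x ^ m * x ^ n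
  ^-distribˡ-+-* x zero n = sym (*-identityˡ _)
  ^-distribˡ-+-* x (suc m) n = trans (cong (x *_) (^-distribˡ-+-* x m n)) (sym (*-assoc x _ _))

  ^-∨≡𝟙ˡ : ∀ {x y} n → x ∨ y ≡ 𝟙 → x ^ n ∨ y ≡ 𝟙
  ^-∨≡𝟙ˡ {y = y} zero _ = ∨-zeroˡ y
  ^-∨≡𝟙ˡ (suc n) x∨y≡𝟙 = *-∨≡𝟙 x∨y≡𝟙 (^-∨≡𝟙ˡ n x∨y≡𝟙)

  ^-∨≡𝟙 : ∀ {x y} m n → x ∨ y ≡ 𝟙 → x ^ m ∨ y ^ n ≡ 𝟙
  ^-∨≡𝟙 m n x∨y≡𝟙 =
    trans (∨-comm _ _) (^-∨≡𝟙ˡ n (trans (∨-comm _ _) (^-∨≡𝟙ˡ m x∨y≡𝟙)))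

  x*y⊕[x⊕y]≡x⊕y : ∀ x y → x * y ⊕ (x ⊕ y) ≡ x ⊕ y
  x*y⊕[x⊕y]≡x⊕y x y = begin
    x * y ⊕ (x ⊕ y)                       ≡⟨ cong (x * y ⊕_) x⊕y≡d⊕y ⟩
    x * y ⊕ (neg (neg (x ⊕ y) ⊕ y) ⊕ y)   ≡⟨ ⊕-assoc _ _ y ⟨
    (x * y ⊕ neg (neg (x ⊕ y) ⊕ y)) ⊕ y   ≡⟨ cong (λ u → (x * y ⊕ neg u) ⊕ y) ∨-swap ⟩
    (x * y ⊕ neg (neg x ⊕ x * y)) ⊕ y     ≡⟨ cong (_⊕ y) (≼-split (x*y≼x x y)) ⟨
    x ⊕ y                                 ∎
    where
    open ≡-Reasoning
    x⊕y≡d⊕y : x ⊕ y ≡ neg (neg (x ⊕ y) ⊕ y) ⊕ y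
    x⊕y≡d⊕y = trans (≼-split (subst (y ≼_) (⊕-comm y x) (x≼x⊕y y x))) (⊕-comm y _)
    ∨-swap : neg (x ⊕ y) ⊕ y ≡ neg x ⊕ x * y
    ∨-swap = begin
      neg (x ⊕ y) ⊕ y               ≡⟨ cong (λ u → neg (u ⊕ y) ⊕ y) (neg-involutive x) ⟨
      neg x ∨ y                     ≡⟨ ∨-comm (neg x) y ⟩
      neg (neg y ⊕ neg x) ⊕ neg x   ≡⟨ cong (λ u → neg u ⊕ neg x) (⊕-comm (neg y) (neg x)) ⟩
      x * y ⊕ neg x                 ≡⟨ ⊕-comm _ (neg x) ⟩
      neg x ⊕ x * y                 ∎

  neg[x*x]∨neg[negx*negx]≡𝟙 : ∀ x → neg (x * x) ∨ neg (neg x * neg x) ≡ 𝟙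
  neg[x*x]∨neg[negx*negx]≡𝟙 x = ≼-reflexive (begin
    neg (neg (x * x)) ⊕ neg (neg x * neg x)   ≡⟨ cong₂ _⊕_ (neg-involutive (x * x)) x⊕x ⟩
    x * x ⊕ (x ⊕ x)                           ≡⟨ x*y⊕[x⊕y]≡x⊕y x x ⟩
    x ⊕ x                                     ≡⟨ x⊕x ⟨
    neg (neg x * neg x)                       ∎)
    where
    open ≡-Reasoning
    x⊕x : neg (neg x * neg x) ≡ x ⊕ x
    x⊕x = trans (neg-* (neg x) (neg x)) (cong₂ _⊕_ (neg-involutive x) (neg-involutive x))

  ¬¬-proper : ∀ {F} → Proper F → Proper (λ x → ¬ ¬ F x)
  ¬¬-proper (y , y∉F) = y , λ ¬y∉F → ¬y∉F y∉F

  Adjoin : (Carrier → Set) → Carrier → Carrier → Set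
  Adjoin F a y = ∃[ n ] ∃[ m ] F m × (m * a ^ n ≼ y)

  module _ {F : Carrier → Set} (F-isFilter : IsFilter F) where
    open IsFilter F-isFilter

    ∈-^ : ∀ {x} → F x → ∀ n → F (x ^ n)
    ∈-^ x∈F zero = has-𝟙
    ∈-^ x∈F (suc n) = *-closed _ _ x∈F (∈-^ x∈F n)

    ∈-⋀ : ∀ {n} (f : Fin n → Carrier) → (∀ i → F (f i)) → F (⋀ f)
    ∈-⋀ {zero} f _ = has-𝟙
    ∈-⋀ {suc n} f f∈F =
      upward _ _ (*-closed _ _ (f∈F zero) ⋀f∈F) (∧-greatest (x*y≼x _ _) (x*y≼y _ _))
      where
      ⋀f∈F = ∈-⋀ (λ i → f (suc i)) (λ i → f∈F (suc i))

    ∈⇒neg≢𝟙 : Proper F → ∀ {x} → F x → neg x ≢ 𝟙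
    ∈⇒neg≢𝟙 (y , y∉F) {x} x∈F negx≡𝟙 = y∉F (upward x y x∈F (subst (_≼ y) (sym x≡𝟘) (𝟘≼x y)))
      where
      x≡𝟘 : x ≡ 𝟘
      x≡𝟘 = trans (sym (neg-involutive x)) (trans (cong neg negx≡𝟙) neg-𝟙)

    ¬¬-isFilter : IsFilter (λ x → ¬ ¬ F x)
    ¬¬-isFilter = record
      { has-𝟙 = λ 𝟙∉F → 𝟙∉F has-𝟙
      ; upward = λ x y ¬¬x∈F x≼y → ¬¬-map (λ x∈F → upward x y x∈F x≼y) ¬¬x∈F
      ; *-closed = λ x y ¬¬x∈F ¬¬y∈F xy∉F →
          ¬¬x∈F (λ x∈F → ¬¬y∈F (λ y∈F → xy∉F (*-closed x y x∈F y∈F)))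
      }

    Adjoin-isFilter : ∀ a → IsFilter (Adjoin F a)
    Adjoin-isFilter a = record
      { has-𝟙 = 0 , 𝟙 , has-𝟙 , x≼𝟙 _
      ; upward = λ { x y (n , m , m∈F , m*aⁿ≼x) x≼y → n , m , m∈F , ≼-trans m*aⁿ≼x x≼y }
      ; *-closed = λ { x y (n , m , m∈F , m*aⁿ≼x) (n′ , m′ , m′∈F , m′*aⁿ′≼y) →
          n + n′ , m * m′ , *-closed m m′ m∈F m′∈F ,
          ≼-trans (≼-reflexive (regroup m m′ n n′)) (*-mono-≼ m*aⁿ≼x m′*aⁿ′≼y) }
      }
      where
      regroup : ∀ m m′ n n′ → (m * m′) * a ^ (n + n′) ≡ (m * a ^ n) * (m′ * a ^ n′)
      regroup m m′ n n′ = trans (cong ((m * m′) *_) (^-distribˡ-+-* a n n′)) (*-interchange m m′ _ _)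

    ⊆-Adjoin : ∀ a x → F x → Adjoin F a x
    ⊆-Adjoin a x x∈F = 0 , x , x∈F , ≼-reflexive (*-identityʳ x)

    ∈-Adjoin : ∀ a → Adjoin F a a
    ∈-Adjoin a = 1 , 𝟙 , has-𝟙 , ≼-reflexive (trans (*-identityˡ _) (*-identityʳ a))

  open IsMaximalFilter

  maximal-≉⇒¬¬-∃∈∉ : ∀ {M N} → IsMaximalFilter M → IsMaximalFilter N →
    ¬ (∀ x → (M x → N x) × (N x → M x)) → ¬ ¬ (∃[ a ] M a × ¬ N a)
  maximal-≉⇒¬¬-∃∈∉ {M} {N} M-max N-max M≉N ∄a = M≉N (λ x → M⊆N x , N⊆M x)
    where
    M⊆¬¬N : ∀ x → M x → ¬ ¬ N x
    M⊆¬¬N x x∈M x∉N = ∄a (x , x∈M , x∉N)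
    N⊆M : ∀ x → N x → M x
    N⊆M x x∈N = maximal M-max (λ y → ¬ ¬ N y) (¬¬-isFilter (isFilter N-max)) (¬¬-proper (proper N-max))
                        M⊆¬¬N x (λ x∉N → x∉N x∈N)
    M⊆N : ∀ x → M x → N x
    M⊆N = maximal N-max M (isFilter M-max) (proper M-max) N⊆M

  ∉maximal⇒¬¬-∃neg∈ : ∀ {M N} → IsFilter M → IsMaximalFilter N →
    ∀ {a} → M a → ¬ N a → ¬ ¬ (∃[ w ] M w × N (neg w))
  ∉maximal⇒¬¬-∃neg∈ {N = N} M-filter N-max {a} a∈M a∉N ∄w =
    a∉N (maximal N-max (Adjoin N a) (Adjoin-isFilter N-filter a) (𝟘 , 𝟘∉Adjoin)
                 (⊆-Adjoin N-filter a) a (∈-Adjoin N-filter a))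
    where
    N-filter = isFilter N-max
    𝟘∉Adjoin : ¬ Adjoin N a 𝟘
    𝟘∉Adjoin (n , m , m∈N , m*aⁿ≼𝟘) =
      ∄w (a ^ n , ∈-^ M-filter a∈M n , IsFilter.upward N-filter m _ m∈N m≼neg[aⁿ])
      where
      m≼neg[aⁿ] : m ≼ neg (a ^ n)
      m≼neg[aⁿ] = subst (m ≼_) (⊕-identity _) (curry-≼ m*aⁿ≼𝟘)

  maximal-≉⇒¬¬-separator : ∀ {M N} → IsMaximalFilter M → IsMaximalFilter N →
    ¬ (∀ x → (M x → N x) × (N x → M x)) → ¬ ¬ (∃[ w ] M w × N (neg w))
  maximal-≉⇒¬¬-separator M-max N-max M≉N ∄w = maximal-≉⇒¬¬-∃∈∉ M-max N-max M≉N
    λ (a , a∈M , a∉N) → ∉maximal⇒¬¬-∃neg∈ (isFilter M-max) N-max a∈M a∉N ∄w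

  module _ {n} (M : Fin n → Carrier → Set) where
    Separated : Fin n → Fin n → Set
    Separated i j = i ≡ j ⊎ ∃[ w ] M i w × M j (neg w)

    ¬¬-separated : (∀ i → IsMaximalFilter (M i)) →
      (∀ i j → i ≢ j → ¬ (∀ x → (M i x → M j x) × (M j x → M i x))) →
      ¬ ¬ (∀ i j → Separated i j)
    ¬¬-separated M-max M-distinct = ¬¬-∀Fin λ i → ¬¬-∀Fin λ j → ¬¬-separatedPair i j
      where
      ¬¬-separatedPair : ∀ i j → ¬ ¬ Separated i j
      ¬¬-separatedPair i j with i ≟ j
      ... | yes i≡j = λ ¬sep → ¬sep (inj₁ i≡j)
      ... | no i≢j = ¬¬-map inj₂ (maximal-≉⇒¬¬-separator (M-max i) (M-max j) (M-distinct i j i≢j))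

    separator : ∀ {i j} → Separated i j → Separated j i → Carrier
    separator (inj₂ (w , _)) (inj₂ (v , _)) = (w * w) * (neg v * neg v)
    separator _ _ = 𝟙

    separator-∈ : (∀ i → IsFilter (M i)) → ∀ {i j} (s : Separated i j) (t : Separated j i) →
      M i (separator s t)
    separator-∈ M-filter {i} (inj₁ _) _ = IsFilter.has-𝟙 (M-filter i)
    separator-∈ M-filter {i} (inj₂ _) (inj₁ _) = IsFilter.has-𝟙 (M-filter i)
    separator-∈ M-filter {i} (inj₂ (w , w∈Mᵢ , _)) (inj₂ (v , _ , negv∈Mᵢ)) =
      *-closed _ _ (*-closed _ _ w∈Mᵢ w∈Mᵢ) (*-closed _ _ negv∈Mᵢ negv∈Mᵢ)
      where open IsFilter (M-filter i)

    separator-codisjoint : ∀ {i j} → i ≢ j → (s : Separated i j) (t : Separated j i) →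
      neg (separator s t) ∨ neg (separator t s) ≡ 𝟙
    separator-codisjoint i≢j (inj₁ i≡j) _ = ⊥-elim (i≢j i≡j)
    separator-codisjoint i≢j (inj₂ _) (inj₁ j≡i) = ⊥-elim (i≢j (sym j≡i))
    separator-codisjoint _ (inj₂ (w , _)) (inj₂ (v , _)) =
      ∨≡𝟙-mono (neg-antitone (x*y≼x _ _)) (neg-antitone (x*y≼y _ _)) (neg[x*x]∨neg[negx*negx]≡𝟙 w)

    module _ (σ : ∀ i j → Separated i j) where
      ⋀separators : Fin n → Carrier
      ⋀separators i = ⋀ (λ j → separator (σ i j) (σ j i))

      ⋀separators-∈ : (∀ i → IsFilter (M i)) → ∀ i → M i (⋀separators i)
      ⋀separators-∈ M-filter i = ∈-⋀ (M-filter i) _ (λ j → separator-∈ M-filter (σ i j) (σ j i))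

      neg-⋀separators-codisjoint : ∀ {i j} → i ≢ j → neg (⋀separators i) ∨ neg (⋀separators j) ≡ 𝟙
      neg-⋀separators-codisjoint {i} {j} i≢j =
        ∨≡𝟙-mono (neg-antitone (⋀-lowerBound _ j)) (neg-antitone (⋀-lowerBound _ i))
                 (separator-codisjoint i≢j (σ i j) (σ j i))

module MonadicProperties (A : MonadicMVAlgebra) where
  open MonadicMVAlgebra A
  open MVProperties mv

  ∀'-𝟘 : ∀' 𝟘 ≡ 𝟘
  ∀'-𝟘 = ≼-antisym (ax1 𝟘) (𝟘≼x _)

  ∀'-𝟙 : ∀' 𝟙 ≡ 𝟙
  ∀'-𝟙 = begin
    ∀' 𝟙              ≡⟨ cong ∀' (ax1 𝟘) ⟨
    ∀' (∀' 𝟘 ⇒ 𝟘)     ≡⟨ ax3 𝟘 𝟘 ⟩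
    ∀' 𝟘 ⇒ ∀' 𝟘       ≡⟨ ≼-refl (∀' 𝟘) ⟩
    𝟙                 ∎
    where open ≡-Reasoning

  ∀'-largest : ∀ {x y} → ∀' x ≼ y → ∀' x ≼ ∀' y
  ∀'-largest {x} {y} ∀x≼y = trans (sym (ax3 x y)) (trans (cong ∀' ∀x≼y) ∀'-𝟙)

  ∀'-mono : ∀ {x y} → x ≼ y → ∀' x ≼ ∀' y
  ∀'-mono {x} x≼y = ∀'-largest (≼-trans (ax1 x) x≼y)

  ∀'-idem : ∀ x → ∀' (∀' x) ≡ ∀' x
  ∀'-idem x = ≼-antisym (ax1 (∀' x)) (∀'-largest (≼-refl (∀' x)))

  ∀'≡𝟙⇒≡𝟙 : ∀ {x} → ∀' x ≡ 𝟙 → x ≡ 𝟙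
  ∀'≡𝟙⇒≡𝟙 {x} ∀x≡𝟙 = 𝟙≼⇒≡𝟙 (subst (_≼ x) ∀x≡𝟙 (ax1 x))

  ∀'-* : ∀ x y → ∀' x * ∀' y ≼ ∀' (x * y)
  ∀'-* x y = uncurry-≼ (begin
    ∀' x                ∼⟨ ∀'-largest (curry-≼ (*-mono-≼ (ax1 x) (ax1 y))) ⟩
    ∀' (∀' y ⇒ x * y)   ≡⟨ ax3 y (x * y) ⟩
    ∀' y ⇒ ∀' (x * y)   ∎)
    where open ≼-Reasoning

  ∀'-⇒ : ∀ x y → ∀' (x ⇒ y) ≼ ∀' x ⇒ ∀' y
  ∀'-⇒ x y = curry-≼ (≼-trans (∀'-* (x ⇒ y) x) (∀'-mono (modus-ponens x y)))

  ∀'-⇒-∀' : ∀ x y → ∀' (x ⇒ y) ≼ ∀' (∀' x ⇒ ∀' y)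
  ∀'-⇒-∀' x y = begin
    ∀' (x ⇒ y)          ∼⟨ ∀'-⇒ x y ⟩
    ∀' x ⇒ ∀' y         ≡⟨ cong (∀' x ⇒_) (∀'-idem y) ⟨
    ∀' x ⇒ ∀' (∀' y)    ≡⟨ ax3 x (∀' y) ⟨
    ∀' (∀' x ⇒ ∀' y)    ∎
    where open ≼-Reasoning

  ∀'-neg : ∀ x → ∀' (neg x) ≡ neg (∃' x)
  ∀'-neg x = begin
    ∀' (neg x)        ≡⟨ cong ∀' (⊕-identity (neg x)) ⟨
    ∀' (neg x ⊕ 𝟘)    ≡⟨ cong (λ u → ∀' (x ⇒ u)) ∀'-𝟘 ⟨
    ∀' (x ⇒ ∀' 𝟘)     ≡⟨ ax2 x 𝟘 ⟩
    ∃' x ⇒ ∀' 𝟘       ≡⟨ cong (∃' x ⇒_) ∀'-𝟘 ⟩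
    neg (∃' x) ⊕ 𝟘    ≡⟨ ⊕-identity _ ⟩
    neg (∃' x)        ∎
    where open ≡-Reasoning

  x≼∃'x : ∀ x → x ≼ ∃' x
  x≼∃'x x = neg-antitone⁻ (subst (_≼ neg x) (∀'-neg x) (ax1 (neg x)))

  ∀'∃' : ∀ x → ∀' (∃' x) ≡ ∃' x
  ∀'∃' x = begin
    ∀' (∃' x)       ≡⟨ cong ∀' (∨-identityʳ _) ⟨
    ∀' (∃' x ∨ 𝟘)   ≡⟨ ax4 x 𝟘 ⟩
    ∃' x ∨ ∀' 𝟘     ≡⟨ cong (∃' x ∨_) ∀'-𝟘 ⟩
    ∃' x ∨ 𝟘        ≡⟨ ∨-identityʳ _ ⟩
    ∃' x            ∎
    where open ≡-Reasoning

  ∃'∀' : ∀ x → ∃' (∀' x) ≡ ∀' x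
  ∃'∀' x = ≼-antisym (trans (sym (ax2 (∀' x) x)) (trans (cong ∀' (≼-refl (∀' x))) ∀'-𝟙)) (x≼∃'x (∀' x))

  ∀'-∨ : ∀ {x y} → ∀' x ≡ x → ∀' y ≡ y → ∀' (x ∨ y) ≡ x ∨ y
  ∀'-∨ {x} {y} ∀x≡x ∀y≡y = begin
    ∀' (x ∨ y)      ≡⟨ cong (λ u → ∀' (u ∨ y)) ∃x≡x ⟨
    ∀' (∃' x ∨ y)   ≡⟨ ax4 x y ⟩
    ∃' x ∨ ∀' y     ≡⟨ cong₂ _∨_ ∃x≡x ∀y≡y ⟩
    x ∨ y           ∎
    where
    open ≡-Reasoning
    ∃x≡x : ∃' x ≡ x
    ∃x≡x = trans (cong ∃' (sym ∀x≡x)) (trans (∃'∀' x) ∀x≡x)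

  ∀'-⇒-∃' : ∀ x y → ∀' (x ⇒ y) ≼ ∀' (∃' x ⇒ ∃' y)
  ∀'-⇒-∃' x y = begin
    ∀' (x ⇒ y)            ∼⟨ ∀'-mono (⇒-monoʳ-≼ x (x≼∃'x y)) ⟩
    ∀' (x ⇒ ∃' y)         ≡⟨ ∀'-idem _ ⟨
    ∀' (∀' (x ⇒ ∃' y))    ≡⟨ cong ∀' ∀'[x⇒∃'y] ⟩
    ∀' (∃' x ⇒ ∃' y)      ∎
    where
    open ≼-Reasoning
    ∀'[x⇒∃'y] : ∀' (x ⇒ ∃' y) ≡ ∃' x ⇒ ∃' y
    ∀'[x⇒∃'y] = trans (cong (λ u → ∀' (x ⇒ u)) (sym (∀'∃' y)))
                      (trans (ax2 x (∃' y)) (cong (∃' x ⇒_) (∀'∃' y)))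

  -- When ∀' e ≡ e, Θ e is the congruence of the monadic filter generated by e.
  Θ≼ : Carrier → Carrier → Carrier → Set
  Θ≼ e x y = ∃[ n ] e ^ n ≼ ∀' (x ⇒ y)

  Θ : Carrier → Carrier → Carrier → Set
  Θ e x y = Θ≼ e x y × Θ≼ e y x

  module _ {e : Carrier} where
    Θ≼-refl : ∀ x → Θ≼ e x x
    Θ≼-refl x = 0 , ≼-reflexive (sym (trans (cong ∀' (≼-refl x)) ∀'-𝟙))

    Θ≼-trans : ∀ {x y z} → Θ≼ e x y → Θ≼ e y z → Θ≼ e x z
    Θ≼-trans {x} {y} {z} (m , eᵐ≼) (n , eⁿ≼) = m + n , (begin
      e ^ (m + n)                   ≡⟨ ^-distribˡ-+-* e m n ⟩
      e ^ m * e ^ n                 ∼⟨ *-mono-≼ eᵐ≼ eⁿ≼ ⟩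
      ∀' (x ⇒ y) * ∀' (y ⇒ z)       ∼⟨ ∀'-* _ _ ⟩
      ∀' ((x ⇒ y) * (y ⇒ z))        ∼⟨ ∀'-mono (⇒-*-trans x y z) ⟩
      ∀' (x ⇒ z)                    ∎)
      where open ≼-Reasoning

    Θ≼-map : (g : Carrier → Carrier) → (∀ x y → ∀' (x ⇒ y) ≼ ∀' (g x ⇒ g y)) →
      ∀ {x y} → Θ≼ e x y → Θ≼ e (g x) (g y)
    Θ≼-map g g-compatible (n , eⁿ≼) = n , ≼-trans eⁿ≼ (g-compatible _ _)

    Θ≼-neg : ∀ {x y} → Θ≼ e x y → Θ≼ e (neg y) (neg x)
    Θ≼-neg {x} {y} (n , eⁿ≼) = n , subst (λ u → e ^ n ≼ ∀' u) (sym (⇒-contrapositive x y)) eⁿ≼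

    Θ-trans : ∀ {x y z} → Θ e x y → Θ e y z → Θ e x z
    Θ-trans (x≼y , y≼x) (y≼z , z≼y) = Θ≼-trans x≼y y≼z , Θ≼-trans z≼y y≼x

    Θ-map : (g : Carrier → Carrier) → (∀ x y → ∀' (x ⇒ y) ≼ ∀' (g x ⇒ g y)) →
      ∀ {x y} → Θ e x y → Θ e (g x) (g y)
    Θ-map g g-compatible (x≼y , y≼x) = Θ≼-map g g-compatible x≼y , Θ≼-map g g-compatible y≼x

    Θ-isCongruence : IsCongruence (Θ e)
    Θ-isCongruence = record
      { refl' = λ x → Θ≼-refl x , Θ≼-refl x
      ; sym' = λ _ _ (x≼y , y≼x) → y≼x , x≼y
      ; trans' = λ _ _ _ → Θ-trans
      ; ⊕-cong = λ x x′ y y′ x~x′ y~y′ →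
          Θ-trans (Θ-map (_⊕ y) (λ a b → ∀'-mono (⇒-≼-⊕ʳ a b y)) x~x′)
                  (Θ-map (x′ ⊕_) (λ a b → ∀'-mono (⇒-≼-⊕ˡ a b x′)) y~y′)
      ; neg-cong = λ _ _ (x≼y , y≼x) → Θ≼-neg y≼x , Θ≼-neg x≼y
      ; ∃-cong = λ _ _ → Θ-map ∃' ∀'-⇒-∃'
      ; ∀-cong = λ _ _ → Θ-map ∀' ∀'-⇒-∀'
      }

    Θ-𝟙 : ∀' e ≡ e → Θ e e 𝟙
    Θ-𝟙 ∀e≡e = (1 , e¹≼∀'[e⇒𝟙]) , (1 , e¹≼∀'[𝟙⇒e])
      where
      e¹≼∀'[e⇒𝟙] : e ^ 1 ≼ ∀' (e ⇒ 𝟙)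
      e¹≼∀'[e⇒𝟙] = subst (e ^ 1 ≼_) (sym (trans (cong ∀' (x≼𝟙 e)) ∀'-𝟙)) (x≼𝟙 (e ^ 1))
      e¹≼∀'[𝟙⇒e] : e ^ 1 ≼ ∀' (𝟙 ⇒ e)
      e¹≼∀'[𝟙⇒e] = ≼-reflexive (trans (*-identityʳ e) (sym (trans (cong ∀' (⇒-identityˡ e)) ∀e≡e)))

  Θ≼-∩ : ∀ {e f x y} → e ∨ f ≡ 𝟙 → Θ≼ e x y → Θ≼ f x y → x ≼ y
  Θ≼-∩ {x = x} {y} e∨f≡𝟙 (m , eᵐ≼) (n , fⁿ≼) =
    ∀'≡𝟙⇒≡𝟙 (𝟙≼⇒≡𝟙 (subst (_≼ ∀' (x ⇒ y)) (^-∨≡𝟙 m n e∨f≡𝟙) (∨-lub eᵐ≼ fⁿ≼)))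

  Θ-∩-isIdentity : ∀ {e f} → e ∨ f ≡ 𝟙 → IsIdentity (λ x y → Θ e x y × Θ f x y)
  Θ-∩-isIdentity e∨f≡𝟙 _ _ ((x≼ₑy , y≼ₑx) , (x≼fy , y≼fx)) =
    ≼-antisym (Θ≼-∩ e∨f≡𝟙 x≼ₑy x≼fy) (Θ≼-∩ e∨f≡𝟙 y≼ₑx y≼fx)

  nontrivial⇒𝟘≢𝟙 : Nontrivial → 𝟘 ≢ 𝟙
  nontrivial⇒𝟘≢𝟙 (x , y , x≢y) 𝟘≡𝟙 = x≢y (trans (≡𝟙 x) (sym (≡𝟙 y)))
    where
    ≡𝟙 : ∀ z → z ≡ 𝟙
    ≡𝟙 z = trans (sym (⊕-identity z)) (trans (cong (z ⊕_) 𝟘≡𝟙) (⊕-absorb z))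

  fsi⇒∨≡𝟙-prime : FSI → ∀ {u v} → ∀' u ≡ u → ∀' v ≡ v → u ∨ v ≡ 𝟙 → u ≡ 𝟙 ⊎ v ≡ 𝟙
  fsi⇒∨≡𝟙-prime (_ , Δ-irreducible) {u} {v} ∀u≡u ∀v≡v u∨v≡𝟙
    with Δ-irreducible (Θ u) (Θ v) Θ-isCongruence Θ-isCongruence (Θ-∩-isIdentity u∨v≡𝟙)
  ... | inj₁ Θu-isIdentity = inj₁ (Θu-isIdentity u 𝟙 (Θ-𝟙 ∀u≡u))
  ... | inj₂ Θv-isIdentity = inj₂ (Θv-isIdentity v 𝟙 (Θ-𝟙 ∀v≡v))

  ∀'-⋁ : ∀ {n} (f : Fin n → Carrier) → (∀ i → ∀' (f i) ≡ f i) → ∀' (⋁ f) ≡ ⋁ f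
  ∀'-⋁ {zero} f _ = ∀'-𝟘
  ∀'-⋁ {suc n} f f-fixed = ∀'-∨ (f-fixed zero) (∀'-⋁ (λ i → f (suc i)) (λ i → f-fixed (suc i)))

  fsi⇒⋁≡𝟙-prime : FSI → ∀ {n} (f : Fin n → Carrier) → (∀ i → ∀' (f i) ≡ f i) →
    ⋁ f ≡ 𝟙 → ∃[ i ] f i ≡ 𝟙
  fsi⇒⋁≡𝟙-prime fsi {zero} f _ 𝟘≡𝟙 = ⊥-elim (nontrivial⇒𝟘≢𝟙 (proj₁ fsi) 𝟘≡𝟙)
  fsi⇒⋁≡𝟙-prime fsi {suc n} f f-fixed ⋁f≡𝟙
    with fsi⇒∨≡𝟙-prime fsi (f-fixed zero) (∀'-⋁ _ (λ i → f-fixed (suc i))) ⋁f≡𝟙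
  ... | inj₁ f₀≡𝟙 = zero , f₀≡𝟙
  ... | inj₂ ⋁fₛ≡𝟙 =
    let i , fₛᵢ≡𝟙 = fsi⇒⋁≡𝟙-prime fsi (λ i → f (suc i)) (λ i → f-fixed (suc i)) ⋁fₛ≡𝟙 in suc i , fₛᵢ≡𝟙

  fsi-width⇒pairwise-∨≡𝟙⇒∃≡𝟙 : FSI → ∀ {k} → WidthLE k → (x : Fin (suc k) → Carrier) →
    (∀ {i j} → i ≢ j → x i ∨ x j ≡ 𝟙) → ∃[ i ] x i ≡ 𝟙
  fsi-width⇒pairwise-∨≡𝟙⇒∃≡𝟙 fsi width x x-codisjoint =
    let i , ∀'xᵢ≡𝟙 = fsi⇒⋁≡𝟙-prime fsi (λ i → ∀' (x i)) (λ i → ∀'-idem (x i)) ⋁∀'x≡𝟙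
    in i , ∀'≡𝟙⇒≡𝟙 ∀'xᵢ≡𝟙
    where
    open ≡-Reasoning
    pairTerm≡𝟙 : ∀ i j → pairTerm x i j ≡ 𝟙
    pairTerm≡𝟙 i j with i <? j
    ... | yes i<j = trans (cong ∀' (x-codisjoint (<⇒≢ i<j))) ∀'-𝟙
    ... | no _ = refl
    ⋁∀'x≡𝟙 : ⋁ (λ i → ∀' (x i)) ≡ 𝟙
    ⋁∀'x≡𝟙 = begin
      ⋁ (λ i → ∀' (x i))                                          ≡⟨ ⇒-identityˡ _ ⟨
      𝟙 ⇒ ⋁ (λ i → ∀' (x i))                                      ≡⟨ cong (_⇒ ⋁ (λ i → ∀' (x i))) ⋀⋀pairTerm≡𝟙 ⟨
      ⋀ (λ i → ⋀ (λ j → pairTerm x i j)) ⇒ ⋁ (λ i → ∀' (x i))    ≡⟨ width x ⟩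
      𝟙                                                           ∎
      where
      ⋀⋀pairTerm≡𝟙 : ⋀ (λ i → ⋀ (λ j → pairTerm x i j)) ≡ 𝟙
      ⋀⋀pairTerm≡𝟙 = ⋀-𝟙 _ (λ i → ⋀-𝟙 _ (pairTerm≡𝟙 i))

mainTheorem20 : (A : MonadicMVAlgebra) (k : ℕ) → 1 ≤ k →
    MonadicMVAlgebra.FSI A → MonadicMVAlgebra.WidthLE A k →
    (M : Fin (suc k) → MonadicMVAlgebra.Carrier A → Set) →
    (∀ i → MonadicMVAlgebra.IsMaximalFilter A (M i)) →
    (∀ i j → ¬ (i ≡ j) → ¬ (∀ x → (M i x → M j x) × (M j x → M i x))) → ⊥
mainTheorem20 A k _ fsi width M M-max M-distinct = ¬¬-separated M M-max M-distinct λ σ →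
  let i , neg[⋀separatorsᵢ]≡𝟙 = fsi-width⇒pairwise-∨≡𝟙⇒∃≡𝟙 fsi width
                                   (λ i → neg (⋀separators M σ i)) (neg-⋀separators-codisjoint M σ)
  in ∈⇒neg≢𝟙 (M-filter i) (proper (M-max i)) (⋀separators-∈ M σ M-filter i) neg[⋀separatorsᵢ]≡𝟙
  where
  open MonadicMVAlgebra A
  open MVProperties mv
  open MonadicProperties A
  open IsMaximalFilter
  M-filter : ∀ i → IsFilter (M i)
  M-filter i = isFilter (M-max i)
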